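{- Let $k\ge 2$ and let $\mathcal{F}$ be a $k$-uniform chain-connected hypergraph with $n$ vertices and $m$ edges. If $n\geq (k-1)^2$, then $m\geq n-(k-1)$.
   Context: Hypergraphs are finite, $k$-uniform (every edge is a $k$-element subset of the vertex set) and have no multiple edges. A nonempty $k$-uniform hypergraph $\mathcal{L}$ is a chain if there is a sequence $v_1,\dots,v_l$ of its vertices in which every vertex of $\mathcal{L}$ appears at least once (possibly several times), $v_1\neq v_l$, and the sets $\{v_i,v_{i+1},\dots,v_{i+k-1}\}$ for $1\le i\le l-k+1$ are pairwise distinct edges of $\mathcal{L}$ and are exactly the edges of $\mathcal{L}$. A $k$-uniform hypergraph is chain-connected if for every pair of its vertices there is a subhypergraph that is a chain and contains both vertices. -}

module Defs where

open import Data.Nat using (ℕ; zero; suc; _≤_; _≤ᵇ_)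
open import Data.Bool using (if_then_else_)
open import Data.Fin using (Fin)
open import Data.Fin.Subset using (Subset; ⊥; ⁅_⁆; _∪_; ∣_∣)
open import Data.List using (List; []; _∷_; length; take; map; foldr; _∷ʳ_)
open import Data.List.Relation.Unary.All using (All)
open import Data.List.Relation.Unary.Unique.Propositional using (Unique)
open import Data.List.Membership.Propositional using (_∈_)
open import Data.Product using (_×_; ∃; ∃-syntax)
open import Relation.Binary.PropositionalEquality using (_≡_; _≢_)

record Hypergraph (k n : ℕ) : Set where
  field
    edges    : List (Subset n)
    distinct : Unique edges
    uniform  : All (λ e → ∣ e ∣ ≡ k) edges

open Hypergraph public

numEdges : ∀ {k n} → Hypergraph k n → ℕ
numEdges H = length (edges H)

windows : {A : Set} → ℕ → List A → List (List A)
windows k [] = []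
windows k (x ∷ xs) =
  if k ≤ᵇ length (x ∷ xs) then take k (x ∷ xs) ∷ windows k xs else []

toSubset : ∀ {n} → List (Fin n) → Subset n
toSubset = foldr (λ x S → ⁅ x ⁆ ∪ S) ⊥

-- The sequence s = v_1 … v_l determines a chain which is a subhypergraph of H:
-- v_1 ≠ v_l, the windows {v_i,…,v_{i+k-1}} are pairwise distinct and are
-- edges of H (and they are exactly the edges of the chain, whose vertices
-- are exactly the entries of s).  Nonemptiness of the chain is l ≥ k.
IsChainSeqIn : ∀ {k n} → Hypergraph k n → List (Fin n) → Set
IsChainSeqIn {k} H s =
    (∃[ a ] ∃[ b ] ∃[ mid ] (s ≡ a ∷ (mid ∷ʳ b) × a ≢ b))
  × k ≤ length s
  × Unique (map toSubset (windows k s))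
  × All (λ e → e ∈ edges H) (map toSubset (windows k s))

ChainConnected : ∀ {k n} → Hypergraph k n → Set
ChainConnected {n = n} H =
  (u v : Fin n) → u ≢ v →
  ∃[ s ] (IsChainSeqIn H s × u ∈ s × v ∈ s)

-- Let p = k − 1 and call two edges adjacent if they share p vertices. Consecutive windows
-- of a chain are adjacent, so every chain lies in one connected component of this relation,
-- and a component with ℓ edges spans at most ℓ + p vertices, since each further edge is
-- glued along p old vertices. By chain-connectedness the vertex sets of the components
-- cover all pairs of vertices, so counting ordered pairs gives n(n − 1) ≤ Σ v(v − 1) over
-- components with v vertices. For v ≤ ℓ + p, v ≤ n and p² ≤ n one has
-- v(v − 1)(n − p) ≤ ℓ n(n − 1); summing over the components yields n − p ≤ Σ ℓ = m.

module Submission where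

open import Defs
open import Data.Nat using (ℕ; _≤_; _∸_; _*_)
open import Data.Nat using (zero; suc; _+_; _<_; z≤n; s≤s; _≤?_; _<?_; _≤ᵇ_)
open import Data.Nat.Properties
open import Data.Nat.Tactic.RingSolver using (solve-∀)
open import Data.Bool using (true; false; if_then_else_)
open import Data.Fin using (Fin; zero; suc; punchIn)
open import Data.Fin.Properties using (punchInᵢ≢i)
open import Data.Fin.Subset using (Subset; ∣_∣; _∩_; _∪_; ⋃; ⁅_⁆; _⊆_) renaming (_∈_ to _∈ˢ_; ⊥ to ∅)
open import Data.Fin.Subset.Properties
  using (∣p∣≤n; p⊆q⇒∣p∣≤∣q∣; ∣⁅x⁆∣≡1; x∈⁅x⁆; ∉⊥; x∈p∪q⁻; x∈p∩q⁺; x∈p∩q⁻; p⊆p∪q; q⊆p∪q;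
         ∪-identityˡ; ∪-identityʳ; ∪-assoc; ∪-comm; ∩-comm)
import Data.Vec as Vec
open import Data.Vec.Properties using ([]=⇒lookup)
open import Data.List using (List; []; _∷_; _++_; length; take; map; concat; filter; lookup; head)
open import Data.List.Properties using (++-assoc; length-++; take-all)
open import Data.List.Membership.Propositional using (_∈_; find; lose)
open import Data.List.Membership.Propositional.Properties using (∈-filter⁻; ∈-concat⁻′; ∈-lookup)
open import Data.List.Relation.Unary.Any using (Any; here; there; any?; index)
open import Data.List.Relation.Unary.Any.Properties using (lookup-index)
open import Data.List.Relation.Unary.All as All using (All; []; _∷_)
open import Data.List.Relation.Unary.All.Properties using (all-filter) renaming (filter⁺ to All-filter⁺)
open import Data.List.Relation.Unary.AllPairs using (AllPairs; []; _∷_)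
open import Data.List.Relation.Unary.AllPairs.Properties using () renaming (filter⁺ to AllPairs-filter⁺)
open import Data.List.Relation.Unary.Linked using (Linked; []; [-]; _∷_; _∷′_)
open import Data.List.Relation.Binary.Permutation.Propositional
  using (_↭_; ↭-refl; ↭-trans; ↭-sym; ↭-reflexive; prep)
open import Data.List.Relation.Binary.Permutation.Propositional.Properties
  using (++⁺ˡ; shifts; ↭-length; ∈-resp-↭)
open import Data.Maybe using (just)
open import Data.Maybe.Relation.Binary.Connected using (Connected; just; just-nothing)
open import Data.Product using (_×_; _,_; ∃-syntax)
open import Data.Sum using (inj₁; inj₂)
open import Data.Empty using (⊥-elim)
open import Function using (_∘_)
open import Relation.Nullary using (¬_; yes; no)
open import Relation.Unary using (Pred; Decidable)
open import Relation.Unary.Properties using (∁?)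
open import Relation.Binary using (Rel; Symmetric)
open import Relation.Binary.PropositionalEquality using (_≡_; _≢_; refl; sym; trans; cong; cong₂; subst)
open import Algebra.Properties.Semiring.Sum +-*-semiring
  using (sum-syntax; ∑-comm; ∑-distrib-+; *-distribˡ-sum; *-distribʳ-sum; sum-remove; sum-cong-≗)

pairs : ℕ → ℕ
pairs v = v * (v ∸ 1)

pairs+n≡n*n : ∀ v → pairs v + v ≡ v * v
pairs+n≡n*n zero    = refl
pairs+n≡n*n (suc v) = trans (+-comm (suc v * v) (suc v)) (sym (*-suc (suc v) v))

pairs-mono-≤ : ∀ {v w} → v ≤ w → pairs v ≤ pairs w
pairs-mono-≤ v≤w = *-mono-≤ v≤w (∸-monoˡ-≤ 1 v≤w)

module _ {p : ℕ} where
  open ≤-Reasoning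

  private
    pairs-bound-small : ∀ {a} → p * p ≤ suc p + a →
                        pairs (suc p) * suc a ≤ pairs (suc p + a)
    pairs-bound-small {a} p²≤n = begin
      suc p * p * suc a                    ≡⟨ expandˡ p a ⟩
      suc p * p + a * p + a * (p * p)      ≤⟨ +-monoʳ-≤ (suc p * p + a * p) (*-monoʳ-≤ a p²≤n) ⟩
      suc p * p + a * p + a * (suc p + a)  ≡⟨ expandʳ p a ⟩
      suc (p + a) * (p + a)                ∎
      where
      expandˡ : ∀ p a → suc p * p * suc a ≡ suc p * p + a * p + a * (p * p)
      expandˡ = solve-∀
      expandʳ : ∀ p a → suc p * p + a * p + a * (suc p + a) ≡ suc (p + a) * (p + a)
      expandʳ = solve-∀

    pairs-bound-large : ∀ {c b} → p * p ≤ suc p + (c + b) →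
                        pairs (suc p + c) * suc (c + b) ≤ suc c * pairs (suc p + (c + b))
    pairs-bound-large {c} {b} p²≤n = +-cancelʳ-≤ (b * n) _ _ (begin
      u + b * n                          ≤⟨ m≤m+n (u + b * n) (b * suc (c + b) * c) ⟩
      u + b * n + b * suc (c + b) * c    ≡⟨ expand p c b ⟩
      w + b * (p * p)                    ≤⟨ +-monoʳ-≤ w (*-monoʳ-≤ b p²≤n) ⟩
      w + b * n                          ∎)
      where
      n u w : ℕ
      n = suc p + (c + b)
      u = suc (p + c) * (p + c) * suc (c + b)
      w = suc c * (suc (p + (c + b)) * (p + (c + b)))
      expand : ∀ p c b → suc (p + c) * (p + c) * suc (c + b) + b * (suc p + (c + b)) + b * suc (c + b) * c
                       ≡ suc c * (suc (p + (c + b)) * (p + (c + b))) + b * (p * p)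
      expand = solve-∀

    pairs-bound⁺ : ∀ {a v e} → p * p ≤ suc p + a → v ≤ suc p + a → v ≤ e + p → 1 ≤ e →
                   pairs v * suc a ≤ e * pairs (suc p + a)
    pairs-bound⁺ {a} {v} {suc e} p²≤n v≤n v≤e+p (s≤s z≤n) with ≤-total v (suc p)
    ... | inj₁ v≤p+1 = begin
      pairs v * suc a          ≤⟨ *-monoˡ-≤ (suc a) (pairs-mono-≤ v≤p+1) ⟩
      pairs (suc p) * suc a    ≤⟨ pairs-bound-small p²≤n ⟩
      pairs (suc p + a)        ≤⟨ m≤n*m (pairs (suc p + a)) (suc e) ⟩
      suc e * pairs (suc p + a) ∎
    ... | inj₂ p+1≤v with m≤n⇒∃[o]m+o≡n p+1≤v
    ... | c , refl with m≤n⇒∃[o]m+o≡n (+-cancelˡ-≤ (suc p) c a v≤n)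
    ... | b , refl = begin
      pairs (suc p + c) * suc (c + b)      ≤⟨ pairs-bound-large p²≤n ⟩
      suc c * pairs (suc p + (c + b))      ≤⟨ *-monoˡ-≤ (pairs (suc p + (c + b))) c+1≤e+1 ⟩
      suc e * pairs (suc p + (c + b))      ∎
      where
      c+1≤e+1 : suc c ≤ suc e
      c+1≤e+1 = +-cancelʳ-≤ p (suc c) (suc e)
        (subst (_≤ suc e + p) (cong suc (+-comm p c)) v≤e+p)

  pairs-bound : ∀ {n v e} → p * p ≤ n → v ≤ n → v ≤ e + p → 1 ≤ e →
                pairs v * (n ∸ p) ≤ e * pairs n
  pairs-bound {n} {v} {e} p²≤n v≤n v≤e+p 1≤e with p <? n
  ... | no p≮n = begin
    pairs v * (n ∸ p)  ≡⟨ cong (pairs v *_) (m≤n⇒m∸n≡0 (≮⇒≥ p≮n)) ⟩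
    pairs v * 0        ≡⟨ *-zeroʳ (pairs v) ⟩
    0                  ≤⟨ z≤n ⟩
    e * pairs n        ∎
  ... | yes p<n with m≤n⇒∃[o]m+o≡n p<n
  ... | a , refl = subst (λ q → pairs v * q ≤ e * pairs (suc p + a)) (sym n∸p≡1+a)
                         (pairs-bound⁺ p²≤n v≤n v≤e+p 1≤e)
    where
    n∸p≡1+a : suc p + a ∸ p ≡ suc a
    n∸p≡1+a = trans (cong (_∸ p) (sym (+-suc p a))) (m+n∸m≡n p (suc a))

∑-mono-≤ : ∀ {n} {f g : Fin n → ℕ} → (∀ i → f i ≤ g i) → ∑[ i < n ] f i ≤ ∑[ i < n ] g i
∑-mono-≤ {zero}  f≤g = z≤n
∑-mono-≤ {suc n} f≤g = +-mono-≤ (f≤g zero) (∑-mono-≤ (f≤g ∘ suc))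

∑-const : ∀ n c → ∑[ i < n ] c ≡ n * c
∑-const zero    c = refl
∑-const (suc n) c = cong (c +_) (∑-const n c)

f≤∑f : ∀ {n} (f : Fin n → ℕ) i → f i ≤ ∑[ j < n ] f j
f≤∑f f zero    = m≤m+n (f zero) _
f≤∑f f (suc i) = ≤-trans (f≤∑f (f ∘ suc) i) (m≤n+m _ (f zero))

f+n≤∑f : ∀ {n} (f : Fin (suc n) → ℕ) u → (∀ {v} → u ≢ v → 1 ≤ f v) →
              f u + n ≤ ∑[ v < suc n ] f v
f+n≤∑f {n} f u f≥1 = begin
  f u + n                             ≡⟨ cong (f u +_) (sym (trans (∑-const n 1) (*-identityʳ n))) ⟩
  f u + ∑[ j < n ] 1                  ≤⟨ +-monoʳ-≤ (f u) (∑-mono-≤ (λ j → f≥1 (punchInᵢ≢i u j ∘ sym))) ⟩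
  f u + ∑[ j < n ] f (punchIn u j)    ≡⟨ sym (sum-remove {i = u} f) ⟩
  ∑[ v < suc n ] f v                  ∎
  where open ≤-Reasoning

indicator : ∀ {n} → Subset n → Fin n → ℕ
indicator S u = if Vec.lookup S u then 1 else 0

∣p∣≡∑indicator : ∀ {n} (S : Subset n) → ∣ S ∣ ≡ ∑[ u < n ] indicator S u
∣p∣≡∑indicator Vec.[]           = refl
∣p∣≡∑indicator (true  Vec.∷ S) = cong suc (∣p∣≡∑indicator S)
∣p∣≡∑indicator (false Vec.∷ S) = ∣p∣≡∑indicator S

indicator-∈ : ∀ {n} {S : Subset n} {u} → u ∈ˢ S → indicator S u ≡ 1
indicator-∈ u∈S = cong (if_then 1 else 0) ([]=⇒lookup u∈S)

indicator-idem : ∀ {n} (S : Subset n) u → indicator S u * indicator S u ≡ indicator S u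
indicator-idem S u with Vec.lookup S u
... | true  = refl
... | false = refl

PairCover : ∀ {m n} → (Fin m → Subset n) → Set
PairCover {n = n} S = ∀ {u v : Fin n} → u ≢ v → ∃[ i ] (u ∈ˢ S i × v ∈ˢ S i)

-- Double counting the triples (i, u, v) with u, v ∈ S i.
pairs≤∑pairs : ∀ {m n} (S : Fin m → Subset n) → PairCover S →
               pairs n ≤ ∑[ i < m ] pairs ∣ S i ∣
pairs≤∑pairs {n = zero}  S cover = z≤n
pairs≤∑pairs {m} {suc n} S cover = +-cancelʳ-≤ (∑[ i < m ] ∣ S i ∣) _ _ (begin
  pairs (suc n) + ∑[ i < m ] ∣ S i ∣
    ≡⟨ +-comm (suc n * n) _ ⟩
  ∑[ i < m ] ∣ S i ∣ + suc n * n
    ≡⟨ cong₂ _+_ diagonal (sym (∑-const (suc n) n)) ⟩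
  ∑[ u < suc n ] together u u + ∑[ u < suc n ] n
    ≡⟨ sym (∑-distrib-+ (λ u → together u u) (λ _ → n)) ⟩
  ∑[ u < suc n ] (together u u + n)
    ≤⟨ ∑-mono-≤ (λ u → f+n≤∑f (together u) u (together≥1 u)) ⟩
  ∑[ u < suc n ] ∑[ v < suc n ] together u v
    ≡⟨ total ⟩
  ∑[ i < m ] (∣ S i ∣ * ∣ S i ∣)
    ≡⟨ sum-cong-≗ (λ i → sym (pairs+n≡n*n ∣ S i ∣)) ⟩
  ∑[ i < m ] (pairs ∣ S i ∣ + ∣ S i ∣)
    ≡⟨ ∑-distrib-+ (λ i → pairs ∣ S i ∣) (λ i → ∣ S i ∣) ⟩
  ∑[ i < m ] pairs ∣ S i ∣ + ∑[ i < m ] ∣ S i ∣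
    ∎)
  where
  open ≤-Reasoning

  χ : Fin m → Fin (suc n) → ℕ
  χ i = indicator (S i)

  together : Fin (suc n) → Fin (suc n) → ℕ
  together u v = ∑[ i < m ] (χ i u * χ i v)

  together≥1 : ∀ u {v} → u ≢ v → 1 ≤ together u v
  together≥1 u {v} u≢v with cover u≢v
  ... | i , u∈ , v∈ = subst (_≤ together u v) (cong₂ _*_ (indicator-∈ u∈) (indicator-∈ v∈))
                            (f≤∑f (λ j → χ j u * χ j v) i)

  diagonal : ∑[ i < m ] ∣ S i ∣ ≡ ∑[ u < suc n ] together u u
  diagonal = begin-equality
    ∑[ i < m ] ∣ S i ∣
      ≡⟨ sum-cong-≗ (λ i → ∣p∣≡∑indicator (S i)) ⟩
    ∑[ i < m ] ∑[ u < suc n ] χ i u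
      ≡⟨ ∑-comm χ ⟩
    ∑[ u < suc n ] ∑[ i < m ] χ i u
      ≡⟨ sum-cong-≗ (λ u → sum-cong-≗ (λ i → sym (indicator-idem (S i) u))) ⟩
    ∑[ u < suc n ] together u u
      ∎

  row : ∀ u → ∑[ v < suc n ] together u v ≡ ∑[ i < m ] (χ i u * ∣ S i ∣)
  row u = begin-equality
    ∑[ v < suc n ] ∑[ i < m ] (χ i u * χ i v)
      ≡⟨ ∑-comm (λ v i → χ i u * χ i v) ⟩
    ∑[ i < m ] ∑[ v < suc n ] (χ i u * χ i v)
      ≡⟨ sum-cong-≗ (λ i → sym (*-distribˡ-sum (χ i u) (χ i))) ⟩
    ∑[ i < m ] (χ i u * ∑[ v < suc n ] χ i v)
      ≡⟨ sum-cong-≗ (λ i → cong (χ i u *_) (sym (∣p∣≡∑indicator (S i)))) ⟩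
    ∑[ i < m ] (χ i u * ∣ S i ∣)
      ∎

  total : ∑[ u < suc n ] ∑[ v < suc n ] together u v ≡ ∑[ i < m ] (∣ S i ∣ * ∣ S i ∣)
  total = begin-equality
    ∑[ u < suc n ] ∑[ v < suc n ] together u v
      ≡⟨ sum-cong-≗ row ⟩
    ∑[ u < suc n ] ∑[ i < m ] (χ i u * ∣ S i ∣)
      ≡⟨ ∑-comm (λ u i → χ i u * ∣ S i ∣) ⟩
    ∑[ i < m ] ∑[ u < suc n ] (χ i u * ∣ S i ∣)
      ≡⟨ sum-cong-≗ (λ i → sym (*-distribʳ-sum ∣ S i ∣ (χ i))) ⟩
    ∑[ i < m ] (∑[ u < suc n ] χ i u * ∣ S i ∣)
      ≡⟨ sum-cong-≗ (λ i → cong (_* ∣ S i ∣) (sym (∣p∣≡∑indicator (S i)))) ⟩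
    ∑[ i < m ] (∣ S i ∣ * ∣ S i ∣)
      ∎

n∸p≤∑-of-PairCover : ∀ {m n p} (S : Fin m → Subset n) (ℓ : Fin m → ℕ) → 1 ≤ p → p * p ≤ n →
                     (∀ i → 1 ≤ ℓ i) → (∀ i → ∣ S i ∣ ≤ ℓ i + p) → PairCover S →
                     n ∸ p ≤ ∑[ i < m ] ℓ i
n∸p≤∑-of-PairCover {n = zero}     {p} _ _ _   _ _ _ _ = ≤-trans (≤-reflexive (0∸n≡0 p)) z≤n
n∸p≤∑-of-PairCover {n = suc zero}     _ _ 1≤p _ _ _ _ = ≤-trans (≤-reflexive (m≤n⇒m∸n≡0 1≤p)) z≤n
n∸p≤∑-of-PairCover {m} {n@(suc (suc _))} {p} S ℓ _ p²≤n ℓ≥1 S≤ℓ+p cover =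
  *-cancelˡ-≤ (pairs n) (begin
    pairs n * (n ∸ p)
      ≤⟨ *-monoˡ-≤ (n ∸ p) (pairs≤∑pairs S cover) ⟩
    ∑[ i < m ] pairs ∣ S i ∣ * (n ∸ p)
      ≡⟨ *-distribʳ-sum (n ∸ p) (λ i → pairs ∣ S i ∣) ⟩
    ∑[ i < m ] (pairs ∣ S i ∣ * (n ∸ p))
      ≤⟨ ∑-mono-≤ (λ i → pairs-bound p²≤n (∣p∣≤n (S i)) (S≤ℓ+p i) (ℓ≥1 i)) ⟩
    ∑[ i < m ] (ℓ i * pairs n)
      ≡⟨ sym (*-distribʳ-sum (pairs n) ℓ) ⟩
    ∑[ i < m ] ℓ i * pairs n
      ≡⟨ *-comm _ (pairs n) ⟩
    pairs n * ∑[ i < m ] ℓ i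
      ∎)
  where open ≤-Reasoning

∣p∪q∣+∣p∩q∣≡∣p∣+∣q∣ : ∀ {n} (p q : Subset n) → ∣ p ∪ q ∣ + ∣ p ∩ q ∣ ≡ ∣ p ∣ + ∣ q ∣
∣p∪q∣+∣p∩q∣≡∣p∣+∣q∣ Vec.[] Vec.[] = refl
∣p∪q∣+∣p∩q∣≡∣p∣+∣q∣ (true Vec.∷ p) (true Vec.∷ q) =
  cong suc (trans (+-suc _ _) (trans (cong suc (∣p∪q∣+∣p∩q∣≡∣p∣+∣q∣ p q)) (sym (+-suc _ _))))
∣p∪q∣+∣p∩q∣≡∣p∣+∣q∣ (true Vec.∷ p) (false Vec.∷ q) = cong suc (∣p∪q∣+∣p∩q∣≡∣p∣+∣q∣ p q)
∣p∪q∣+∣p∩q∣≡∣p∣+∣q∣ (false Vec.∷ p) (true Vec.∷ q) =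
  trans (cong suc (∣p∪q∣+∣p∩q∣≡∣p∣+∣q∣ p q)) (sym (+-suc _ _))
∣p∪q∣+∣p∩q∣≡∣p∣+∣q∣ (false Vec.∷ p) (false Vec.∷ q) = ∣p∪q∣+∣p∩q∣≡∣p∣+∣q∣ p q

∣p∪q∣≤∣p∣+∣q∣ : ∀ {n} (p q : Subset n) → ∣ p ∪ q ∣ ≤ ∣ p ∣ + ∣ q ∣
∣p∪q∣≤∣p∣+∣q∣ p q = ≤-trans (m≤m+n ∣ p ∪ q ∣ ∣ p ∩ q ∣) (≤-reflexive (∣p∪q∣+∣p∩q∣≡∣p∣+∣q∣ p q))

∣p∪q∣+k≤∣p∣+∣q∣ : ∀ {n k} (p q : Subset n) → k ≤ ∣ p ∩ q ∣ → ∣ p ∪ q ∣ + k ≤ ∣ p ∣ + ∣ q ∣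
∣p∪q∣+k≤∣p∣+∣q∣ p q k≤∣p∩q∣ =
  ≤-trans (+-monoʳ-≤ ∣ p ∪ q ∣ k≤∣p∩q∣) (≤-reflexive (∣p∪q∣+∣p∩q∣≡∣p∣+∣q∣ p q))

⊆⋃ : ∀ {n} {g : Subset n} {gs} → g ∈ gs → g ⊆ ⋃ gs
⊆⋃              (here refl) = p⊆p∪q _
⊆⋃ {gs = h ∷ gs} (there g∈)  = q⊆p∪q h (⋃ gs) ∘ ⊆⋃ g∈

⋃-++ : ∀ {n} (gs hs : List (Subset n)) → ⋃ (gs ++ hs) ≡ ⋃ gs ∪ ⋃ hs
⋃-++ []       hs = sym (∪-identityˡ (⋃ hs))
⋃-++ (g ∷ gs) hs = trans (cong (g ∪_) (⋃-++ gs hs)) (sym (∪-assoc g (⋃ gs) (⋃ hs)))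

∈-toSubset : ∀ {n} {u : Fin n} {l} → u ∈ l → u ∈ˢ toSubset l
∈-toSubset (here refl) = p⊆p∪q _ (x∈⁅x⁆ _)
∈-toSubset {l = x ∷ l} (there u∈l) = q⊆p∪q ⁅ x ⁆ (toSubset l) (∈-toSubset u∈l)

∣toSubset-∷∣≤ : ∀ {n} (x : Fin n) l → ∣ toSubset (x ∷ l) ∣ ≤ suc ∣ toSubset l ∣
∣toSubset-∷∣≤ x l = ≤-trans (∣p∪q∣≤∣p∣+∣q∣ ⁅ x ⁆ (toSubset l)) (≤-reflexive (cong (_+ _) (∣⁅x⁆∣≡1 x)))

toSubset-take-⊆ : ∀ {n} k (xs : List (Fin n)) → toSubset (take k xs) ⊆ toSubset (take (suc k) xs)
toSubset-take-⊆ zero    xs       u∈ = ⊥-elim (∉⊥ u∈)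
toSubset-take-⊆ (suc k) []       u∈ = u∈
toSubset-take-⊆ (suc k) (x ∷ xs) u∈ with x∈p∪q⁻ ⁅ x ⁆ _ u∈
... | inj₁ u∈x  = p⊆p∪q _ u∈x
... | inj₂ u∈xs = q⊆p∪q ⁅ x ⁆ _ (toSubset-take-⊆ k xs u∈xs)

∑-length-lookup : ∀ {A : Set} (xss : List (List A)) →
                  ∑[ i < length xss ] length (lookup xss i) ≡ length (concat xss)
∑-length-lookup []         = refl
∑-length-lookup (xs ∷ xss) = trans (cong (length xs +_) (∑-length-lookup xss)) (sym (length-++ xs))

concat-filter-↭ : ∀ {A : Set} {ℓ} {P : Pred (List A) ℓ} (P? : Decidable P) (xss : List (List A)) →
                  concat (filter P? xss) ++ concat (filter (∁? P?) xss) ↭ concat xss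
concat-filter-↭ P? []         = ↭-refl
concat-filter-↭ P? (xs ∷ xss) with P? xs
... | yes _ = ↭-trans (↭-reflexive (++-assoc xs _ _)) (++⁺ˡ xs (concat-filter-↭ P? xss))
... | no  _ = ↭-trans (shifts (concat (filter P? xss)) xs) (++⁺ˡ xs (concat-filter-↭ P? xss))

AllPairs-¬R⇒≡ : ∀ {A : Set} {ℓ} {R : Rel A ℓ} {xs x y} → Symmetric R → AllPairs R xs →
                x ∈ xs → y ∈ xs → ¬ R x y → x ≡ y
AllPairs-¬R⇒≡ sym-R _           (here refl) (here refl) _   = refl
AllPairs-¬R⇒≡ sym-R (Rx ∷ _)    (here refl) (there y∈)  ¬Rxy = ⊥-elim (¬Rxy (All.lookup Rx y∈))
AllPairs-¬R⇒≡ sym-R (Rx ∷ _)    (there x∈)  (here refl) ¬Rxy = ⊥-elim (¬Rxy (sym-R (All.lookup Rx x∈)))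
AllPairs-¬R⇒≡ sym-R (_ ∷ Rxs)   (there x∈)  (there y∈)  ¬Rxy = AllPairs-¬R⇒≡ sym-R Rxs x∈ y∈ ¬Rxy

windows-cons : ∀ {A : Set} k (x : A) xs → k ≤ length (x ∷ xs) →
               windows k (x ∷ xs) ≡ take k (x ∷ xs) ∷ windows k xs
windows-cons k x xs long with k ≤ᵇ length (x ∷ xs) | ≤⇒≤ᵇ long
... | true | _ = refl

windows-short : ∀ {A : Set} k (xs : List A) → length xs < k → windows k xs ≡ []
windows-short k []       _     = refl
windows-short k (x ∷ xs) short with k ≤ᵇ length (x ∷ xs) | ≤ᵇ⇒≤ k (length (x ∷ xs))
... | false | _    = refl
... | true  | long = ⊥-elim (<⇒≱ short (long _))

-- Components of the adjacency relation between edges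

module Components {n : ℕ} (p : ℕ) where

  Adjacent : Subset n → Subset n → Set
  Adjacent f g = p ≤ ∣ f ∩ g ∣

  Touches : Subset n → List (Subset n) → Set
  Touches f = Any (Adjacent f)

  touches? : ∀ f → Decidable (Touches f)
  touches? f = any? (λ g → p ≤? ∣ f ∩ g ∣)

  Separated : List (Subset n) → List (Subset n) → Set
  Separated B C = ∀ {g h} → g ∈ B → h ∈ C → ¬ Adjacent g h

  separated-sym : Symmetric Separated
  separated-sym sep {h} {g} h∈ g∈ adj = sep g∈ h∈ (subst (p ≤_) (cong ∣_∣ (∩-comm h g)) adj)

  record Compact (B : List (Subset n)) : Set where
    field
      nonempty : 1 ≤ length B
      spans    : ∣ ⋃ B ∣ ≤ length B + p

  record Decomposition (es : List (Subset n)) : Set where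
    field
      blocks    : List (List (Subset n))
      partition : concat blocks ↭ es
      compact   : All Compact blocks
      separated : AllPairs Separated blocks

  open Compact
  open Decomposition

  -- Each touching block meets f ∪ (the blocks glued so far) in at least p vertices, so it
  -- contributes at most its number of edges in new vertices.
  glue-touching : ∀ f → ∣ f ∣ ≡ suc p → (bs : List (List (Subset n))) →
                  All Compact bs → All (Touches f) bs →
                  ∣ f ∪ ⋃ (concat bs) ∣ ≤ suc (length (concat bs) + p)
  glue-touching f ∣f∣ [] [] [] = ≤-reflexive (trans (cong ∣_∣ (∪-identityʳ f)) ∣f∣)
  glue-touching f ∣f∣ (B ∷ bs) (cB ∷ cbs) (tB ∷ tbs) = +-cancelʳ-≤ p _ _ (begin
    ∣ f ∪ ⋃ (B ++ concat bs) ∣ + p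
      ≡⟨ cong (λ s → ∣ s ∣ + p) regroup ⟩
    ∣ X ∪ ⋃ B ∣ + p
      ≤⟨ ∣p∪q∣+k≤∣p∣+∣q∣ X (⋃ B) shared ⟩
    ∣ X ∣ + ∣ ⋃ B ∣
      ≤⟨ +-mono-≤ (glue-touching f ∣f∣ bs cbs tbs) (spans cB) ⟩
    suc (length (concat bs) + p) + (length B + p)
      ≡⟨ rearrange (length (concat bs)) (length B) p ⟩
    suc (length B + length (concat bs) + p) + p
      ≡⟨ cong (λ l → suc (l + p) + p) (sym (length-++ B)) ⟩
    suc (length (B ++ concat bs) + p) + p
      ∎)
    where
    open ≤-Reasoning
    X : Subset n
    X = f ∪ ⋃ (concat bs)

    regroup : f ∪ ⋃ (B ++ concat bs) ≡ X ∪ ⋃ B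
    regroup = trans (cong (f ∪_) (trans (⋃-++ B (concat bs)) (∪-comm (⋃ B) _)))
                    (sym (∪-assoc f (⋃ (concat bs)) (⋃ B)))

    shared : p ≤ ∣ X ∩ ⋃ B ∣
    shared with find tB
    ... | g , g∈B , p≤∣f∩g∣ = ≤-trans p≤∣f∩g∣ (p⊆q⇒∣p∣≤∣q∣ f∩g⊆X∩⋃B)
      where
      f∩g⊆X∩⋃B : f ∩ g ⊆ X ∩ ⋃ B
      f∩g⊆X∩⋃B u∈ with x∈p∩q⁻ f g u∈
      ... | u∈f , u∈g = x∈p∩q⁺ (p⊆p∪q _ u∈f , ⊆⋃ g∈B u∈g)

    rearrange : ∀ a b p → suc (a + p) + (b + p) ≡ suc (b + a + p) + p
    rearrange = solve-∀

  insert : ∀ {f es} → ∣ f ∣ ≡ suc p → Decomposition es → Decomposition (f ∷ es)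
  insert {f} ∣f∣ D = record
    { blocks    = (f ∷ concat touching) ∷ rest
    ; partition = prep f (↭-trans (concat-filter-↭ (touches? f) (blocks D)) (partition D))
    ; compact   = record { nonempty = s≤s z≤n
                         ; spans    = glue-touching f ∣f∣ touching
                                        (All-filter⁺ (touches? f) (compact D))
                                        (all-filter (touches? f) (blocks D)) }
                  ∷ All-filter⁺ (∁? (touches? f)) (compact D)
    ; separated = All.tabulate separated-from-rest
                  ∷ AllPairs-filter⁺ (∁? (touches? f)) (separated D)
    }
    where
    touching rest : List (List (Subset n))
    touching = filter (touches? f) (blocks D)
    rest     = filter (∁? (touches? f)) (blocks D)

    separated-from-rest : ∀ {C} → C ∈ rest → Separated (f ∷ concat touching) C
    separated-from-rest {C} C∈ g∈ h∈C adj with ∈-filter⁻ (∁? (touches? f)) {xs = blocks D} C∈ | g∈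
    ... | _ , f-misses-C | here refl = f-misses-C (lose h∈C adj)
    ... | C∈D , f-misses-C | there g∈touching with ∈-concat⁻′ touching g∈touching
    ... | B , g∈B , B∈ with ∈-filter⁻ (touches? f) {xs = blocks D} B∈
    ... | B∈D , f-touches-B = f-misses-C (subst (Touches f) B≡C f-touches-B)
      where
      B≡C : B ≡ C
      B≡C = AllPairs-¬R⇒≡ separated-sym (separated D) B∈D C∈D (λ sep → sep g∈B h∈C adj)

  decompose : (es : List (Subset n)) → All (λ e → ∣ e ∣ ≡ suc p) es → Decomposition es
  decompose []       []          =
    record { blocks = [] ; partition = ↭-refl ; compact = [] ; separated = [] }
  decompose (e ∷ es) (∣e∣ ∷ ∣es∣) = insert ∣e∣ (decompose es ∣es∣)

  block-of : ∀ {es e} (D : Decomposition es) → e ∈ es → ∃[ B ] (B ∈ blocks D × e ∈ B)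
  block-of D e∈es with ∈-concat⁻′ (blocks D) (∈-resp-↭ (↭-sym (partition D)) e∈es)
  ... | B , e∈B , B∈ = B , B∈ , e∈B

  walk-in-block : ∀ {es ws w} (D : Decomposition es) → Linked Adjacent ws → All (_∈ es) ws →
                  w ∈ ws → ∃[ B ] (B ∈ blocks D × All (_∈ B) ws)
  walk-in-block D [-] (w∈es ∷ []) _ with block-of D w∈es
  ... | B , B∈ , w∈B = B , B∈ , w∈B ∷ []
  walk-in-block D (adj ∷ linked) (w∈es ∷ ws∈es) _
    with walk-in-block D linked ws∈es (here refl) | block-of D w∈es
  ... | B , B∈ , ws⊆B | B′ , B′∈ , w∈B′ = B , B∈ , subst (_ ∈_) B′≡B w∈B′ ∷ ws⊆B
    where
    B′≡B : B′ ≡ B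
    B′≡B = AllPairs-¬R⇒≡ separated-sym (separated D) B′∈ B∈ (λ sep → sep w∈B′ (All.head ws⊆B) adj)

  window-adjacent : ∀ x (xs : List (Fin n)) → ∣ toSubset (take (suc p) (x ∷ xs)) ∣ ≡ suc p →
                    Adjacent (toSubset (take (suc p) (x ∷ xs))) (toSubset (take (suc p) xs))
  window-adjacent x xs ∣w∣ = ≤-trans p≤∣T∣ (p⊆q⇒∣p∣≤∣q∣ T⊆∩)
    where
    T : Subset n
    T = toSubset (take p xs)

    p≤∣T∣ : p ≤ ∣ T ∣
    p≤∣T∣ = ≤-pred (subst (_≤ suc ∣ T ∣) ∣w∣ (∣toSubset-∷∣≤ x (take p xs)))

    T⊆∩ : T ⊆ toSubset (take (suc p) (x ∷ xs)) ∩ toSubset (take (suc p) xs)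
    T⊆∩ u∈T = x∈p∩q⁺ (q⊆p∪q ⁅ x ⁆ T u∈T , toSubset-take-⊆ p xs u∈T)

  windows-linked : ∀ s → All (λ w → ∣ w ∣ ≡ suc p) (map toSubset (windows (suc p) s)) →
                   Linked Adjacent (map toSubset (windows (suc p) s))
  windows-linked []       _     = []
  windows-linked (x ∷ xs) sizes with suc p ≤? length (x ∷ xs)
  ... | no short rewrite windows-short (suc p) (x ∷ xs) (≰⇒> short) = []
  ... | yes long rewrite windows-cons (suc p) x xs long with sizes
  ...   | ∣w∣ ∷ sizes′ = adjacent-to-next xs ∣w∣ ∷′ windows-linked xs sizes′
    where
    adjacent-to-next : ∀ xs → ∣ toSubset (take (suc p) (x ∷ xs)) ∣ ≡ suc p →
                       Connected Adjacent (just (toSubset (take (suc p) (x ∷ xs))))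
                                          (head (map toSubset (windows (suc p) xs)))
    adjacent-to-next []       _   = just-nothing
    adjacent-to-next (y ∷ ys) ∣w∣ with suc p ≤? length (y ∷ ys)
    ... | yes long′ rewrite windows-cons (suc p) y ys long′ = just (window-adjacent x (y ∷ ys) ∣w∣)
    ... | no short rewrite windows-short (suc p) (y ∷ ys) (≰⇒> short) = just-nothing

  windows-cover : ∀ {u : Fin n} s → suc p ≤ length s → u ∈ s →
                  Any (u ∈ˢ_) (map toSubset (windows (suc p) s))
  windows-cover {u} (x ∷ xs) long u∈s
    rewrite windows-cons (suc p) x xs long with u∈s | suc p ≤? length xs
  ... | here refl  | _         = here (∈-toSubset {l = x ∷ take p xs} (here refl))
  ... | there u∈xs | yes long′ = there (windows-cover xs long′ u∈xs)
  ... | there u∈xs | no short  =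
    here (subst (λ l → u ∈ˢ toSubset l) (sym (take-all (suc p) (x ∷ xs) (≰⇒> short)))
                (∈-toSubset (there u∈xs)))

  chain-in-block : ∀ {s} (H : Hypergraph (suc p) n) (D : Decomposition (edges H)) → IsChainSeqIn H s →
                   ∃[ B ] (B ∈ blocks D × (∀ {u} → u ∈ s → u ∈ˢ ⋃ B))
  chain-in-block {[]}     H D (_ , () , _)
  chain-in-block {x ∷ xs} H D (_ , long , _ , windows∈H)
    with find (windows-cover (x ∷ xs) long (here refl))
  ... | _ , first-window , _
    with walk-in-block D (windows-linked (x ∷ xs) (All.map (All.lookup (uniform H)) windows∈H))
                       windows∈H first-window
  ... | B , B∈ , windows⊆B = B , B∈ , λ u∈s →
    let _ , w∈windows , u∈w = find (windows-cover (x ∷ xs) long u∈s)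
    in ⊆⋃ (All.lookup windows⊆B w∈windows) u∈w

mainTheorem1 : (k n : ℕ) → 2 ≤ k → (F : Hypergraph k n) → ChainConnected F →
                 (k ∸ 1) * (k ∸ 1) ≤ n → n ∸ (k ∸ 1) ≤ numEdges F
mainTheorem1 (suc (suc p)) n (s≤s (s≤s z≤n)) F chain-connected p²≤n = begin
  n ∸ suc p                                       ≤⟨ n∸p≤∑-of-PairCover vertices size (s≤s z≤n) p²≤n
                                                       (nonempty ∘ compact-at) (spans ∘ compact-at) cover ⟩
  ∑[ i < length blocks ] length (lookup blocks i) ≡⟨ ∑-length-lookup blocks ⟩
  length (concat blocks)                          ≡⟨ ↭-length partition ⟩
  numEdges F                                      ∎
  where
  open ≤-Reasoning
  open Components (suc p)
  D : Decomposition (edges F)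
  D = decompose (edges F) (uniform F)
  open Decomposition D
  open Compact

  vertices : Fin (length blocks) → Subset n
  vertices i = ⋃ (lookup blocks i)

  size : Fin (length blocks) → ℕ
  size i = length (lookup blocks i)

  compact-at : ∀ i → Compact (lookup blocks i)
  compact-at i = All.lookup compact (∈-lookup i)

  cover : PairCover vertices
  cover u≢v with chain-connected _ _ u≢v
  ... | s , chain , u∈s , v∈s with chain-in-block F D chain
  ... | B , B∈ , s⊆B = index B∈ , in-lookup (s⊆B u∈s) , in-lookup (s⊆B v∈s)
    where
    in-lookup : ∀ {x} → x ∈ˢ ⋃ B → x ∈ˢ vertices (index B∈)
    in-lookup = subst (λ C → _ ∈ˢ ⋃ C) (lookup-index B∈)
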